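{- Let $k\ge 1$ and let $A,B$ be an instance of $k$-Max-Duo, i.e. each letter occurs at most $k$ times in each of $A$ and $B$. Let $G=(V,E)$ be the graph constructed from $A,B$ as described in the context. Then every vertex of $G$ has degree at most $6(k-1)$.
   Context: Let $A=(a_1,\dots,a_n)$ and $B=(b_1,\dots,b_n)$ be strings over an alphabet such that $B$ is a permutation of $A$. Let $H=(A,B,F)$ be the bipartite graph with vertex classes $a_1,\dots,a_n$ and $b_1,\dots,b_n$, and an edge $e_{i,j}$ between $a_i$ and $b_j$ if and only if the letters $a_i$ and $b_j$ are equal. Let $G=(V,E)$ be the graph with vertex set $V=\{v_{i,j}: 1\le i,j\le n-1,\ e_{i,j},e_{i+1,j+1}\in F\}$, where $v_{i,j}$ represents the pair $(e_{i,j},e_{i+1,j+1})$. Two distinct vertices are adjacent if and only if their corresponding pairs of edges cannot both be contained in a common perfect matching of $H$. -}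

module Defs where

open import Data.Nat using (ℕ; suc; _≤_)
open import Data.Fin using (Fin; inject₁; suc)
open import Data.Product using (_×_; _,_; ∃)
open import Data.List using (List; length)
open import Data.List.Relation.Unary.All using (All)
open import Data.List.Relation.Unary.Unique.Propositional using (Unique)
open import Function.Bundles using (_↔_; Inverse)
open import Relation.Binary.PropositionalEquality using (_≡_; _≢_)
open import Relation.Nullary using (¬_)

-- Strings of length n = suc m over an alphabet L are functions Fin (suc m) → L
-- (positions are 0-based: position x corresponds to a_{x+1}).

AtMostOccurrences : {L : Set} {n : ℕ} → ℕ → (Fin n → L) → Set
AtMostOccurrences {L} {n} k S =
  (c : L) (xs : List (Fin n)) → Unique xs → All (λ x → S x ≡ c) xs → length xs ≤ k

module DuoGraph {L : Set} {m : ℕ} (A B : Fin (suc m) → L) where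

  -- A perfect matching of H: a bijection σ of positions with a_x = b_{σ x};
  -- e_{x,y} belongs to the matching iff σ x = y.
  PerfectMatching : Set
  PerfectMatching = ∃ λ (σ : Fin (suc m) ↔ Fin (suc m)) → ∀ x → A x ≡ B (Inverse.to σ x)

  -- Vertex index (i , j) : Fin m × Fin m (0-based) stands for v_{i+1,j+1},
  -- i.e. the pair (e_{i,j} , e_{i+1,j+1}) in 0-based positions.
  IsVertex : Fin m × Fin m → Set
  IsVertex (i , j) = (A (inject₁ i) ≡ B (inject₁ j)) × (A (suc i) ≡ B (suc j))

  Contains : PerfectMatching → Fin m × Fin m → Set
  Contains (σ , _) (i , j) =
    (Inverse.to σ (inject₁ i) ≡ inject₁ j) × (Inverse.to σ (suc i) ≡ suc j)

  Adjacent : Fin m × Fin m → Fin m × Fin m → Set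
  Adjacent v w = (v ≢ w) × ¬ (∃ λ (M : PerfectMatching) → Contains M v × Contains M w)

  DegreeAtMost : Fin m × Fin m → ℕ → Set
  DegreeAtMost v d =
    (ws : List (Fin m × Fin m)) → Unique ws →
    All (λ w → IsVertex w × Adjacent v w) ws → length ws ≤ d

module Submission where

-- Write an edge e_{x,y} of H as the position pair (x , y); the vertex v = (i , j)
-- of G is the pair of edges  lower v = (i , j)  and  upper v = (i+1 , j+1).
-- Two edges CONFLICT when they share exactly one endpoint; otherwise they are
-- COMPATIBLE.  The proof has three parts.
--  1. Matchings: given one perfect matching of H, any list of pairwise compatible
--     edges of H lies in a common perfect matching (redirect the matching along
--     each edge in turn with a transposition).
--  2. Neighbours: hence, if w is adjacent to v, some edge of v conflicts with some
--     edge of w. Counting: the neighbours w whose edge conflicts with a fixed edge (x , y)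
--     on the A-side (resp. B-side) are determined by an endpoint different from
--     y (resp. x) carrying the same letter, so there are at most k - 1 of them.
--     Three edge pairs times two sides give 6 (k - 1).

open import Defs
open import Data.Nat using (ℕ; suc; _≤_; _*_; _∸_; _+_; z≤n; s≤s)
open import Data.Nat.Properties using (≤-trans; ≤-reflexive; +-mono-≤; +-suc; ∸-monoˡ-≤)
open import Data.Nat.Tactic.RingSolver using (solve-∀)
open import Data.Fin using (Fin; inject₁; _≟_)
open import Data.Fin.Properties using (suc-injective; inject₁-injective)
open import Data.Fin.Permutation using (transpose; _∘ₚ_; inverseʳ)
import Data.Fin.Permutation.Components as PC
open import Data.Product using (_×_; ∃; Σ; _,_; proj₁; proj₂)
open import Data.Sum using (_⊎_; inj₁; inj₂)
open import Data.Empty using (⊥-elim)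
open import Data.List using (List; []; _∷_; length; map; filter)
open import Data.List.Properties using (length-map)
open import Data.List.Relation.Unary.All as All using (All; []; _∷_)
import Data.List.Relation.Unary.All.Properties as AllP
open import Data.List.Relation.Unary.AllPairs using (AllPairs; []; _∷_)
open import Data.List.Relation.Unary.Unique.Propositional using (Unique)
import Data.List.Relation.Unary.Unique.Propositional.Properties as UniqueP
open import Function using (_∘_)
open import Function.Bundles using (_↔_; Inverse)
open import Relation.Binary.PropositionalEquality using (_≡_; _≢_; refl; sym; trans; cong; cong₂)
open import Relation.Nullary using (¬_; Dec; yes; no; ¬?)
open import Relation.Nullary.Decidable using (_×-dec_; _⊎-dec_)
open import Level using (0ℓ)
open import Relation.Unary using (Pred; Decidable; _∩_; _∪_)

Bounded : {W : Set} → Pred W 0ℓ → ℕ → Set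
Bounded P d = ∀ ws → Unique ws → All P ws → length ws ≤ d

bounded-mono : {W : Set} {P Q : Pred W 0ℓ} {d : ℕ} →
  (∀ {w} → Q w → P w) → Bounded P d → Bounded Q d
bounded-mono Q⇒P bP ws u qs = bP ws u (All.map Q⇒P qs)

bounded-≤ : {W : Set} {P : Pred W 0ℓ} {d d' : ℕ} → d ≤ d' → Bounded P d → Bounded P d'
bounded-≤ d≤d' bP ws u ps = ≤-trans (bP ws u ps) d≤d'

length-split : {W : Set} {P : Pred W 0ℓ} (P? : Decidable P) (ws : List W) →
  length ws ≤ length (filter P? ws) + length (filter (¬? ∘ P?) ws)
length-split P? [] = z≤n
length-split P? (w ∷ ws) with P? w
... | yes _ = s≤s (length-split P? ws)
... | no _  = ≤-trans (s≤s (length-split P? ws)) (≤-reflexive (sym (+-suc _ _)))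

bounded-∪ : {W : Set} {R P Q : Pred W 0ℓ} {a b : ℕ} → Decidable P →
  Bounded (R ∩ P) a → Bounded (R ∩ Q) b → Bounded (R ∩ (P ∪ Q)) (a + b)
bounded-∪ {R = R} {P} {Q} P? bP bQ ws u rs =
  ≤-trans (length-split P? ws)
    (+-mono-≤ (bP _ (UniqueP.filter⁺ P? u)
                 (All.zipWith inP (AllP.filter⁺ P? rs , AllP.all-filter P? ws)))
              (bQ _ (UniqueP.filter⁺ (¬? ∘ P?) u)
                 (All.zipWith inQ (AllP.filter⁺ (¬? ∘ P?) rs , AllP.all-filter (¬? ∘ P?) ws))))
  where
  inP : ∀ {w} → (R ∩ (P ∪ Q)) w × P w → (R ∩ P) w
  inP ((r , _) , p) = r , p
  inQ : ∀ {w} → (R ∩ (P ∪ Q)) w × ¬ P w → (R ∩ Q) w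
  inQ ((r , inj₁ p) , ¬p) = ⊥-elim (¬p p)
  inQ ((r , inj₂ q) , _)  = r , q

unique-map : {W X : Set} {P : Pred W 0ℓ} (f : W → X) →
  (∀ {w w'} → P w → P w' → f w ≡ f w' → w ≡ w') →
  ∀ {ws} → Unique ws → All P ws → Unique (map f ws)
unique-map f inj [] [] = []
unique-map f inj (w∉ws ∷ u) (p ∷ ps) =
  AllP.map⁺ (All.zipWith (λ (w≢w' , p') e → w≢w' (inj p p' e)) (w∉ws , ps)) ∷ unique-map f inj u ps

-- Core count: if f sends the P-elements injectively to positions of S other than y₀
-- that carry the letter S y₀, then together with y₀ they are at most k positions.
same-letter-bound : {W L : Set} {n k : ℕ} {P : Pred W 0ℓ} (S : Fin n → L) →
  AtMostOccurrences k S → (y₀ : Fin n) (f : W → Fin n) →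
  (∀ {w} → P w → S (f w) ≡ S y₀) → (∀ {w} → P w → f w ≢ y₀) →
  (∀ {w w'} → P w → P w' → f w ≡ f w' → w ≡ w') → Bounded P (k ∸ 1)
same-letter-bound S occ y₀ f letter ≢y₀ inj ws u ps =
  ≤-trans (≤-reflexive (sym (length-map f ws)))
    (∸-monoˡ-≤ 1 (occ (S y₀) (y₀ ∷ map f ws) (y₀∉ ∷ unique-map f inj u ps)
                    (refl ∷ AllP.map⁺ (All.map letter ps))))
  where
  y₀∉ : All (y₀ ≢_) (map f ws)
  y₀∉ = AllP.map⁺ (All.map (λ p e → ≢y₀ p (sym e)) ps)

transpose-left : ∀ {n} (i j : Fin n) → PC.transpose i j i ≡ j
transpose-left i j with i ≟ i
... | yes _  = refl
... | no i≢i = ⊥-elim (i≢i refl)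

transpose-other : ∀ {n} {i j z : Fin n} → z ≢ i → z ≢ j → PC.transpose i j z ≡ z
transpose-other {i = i} {j} {z} z≢i z≢j with z ≟ i
... | yes z≡i = ⊥-elim (z≢i z≡i)
... | no _ with z ≟ j
...   | yes z≡j = ⊥-elim (z≢j z≡j)
...   | no _    = refl

transpose-right : ∀ {n} {i j z : Fin n} → z ≢ i → z ≡ j → PC.transpose i j z ≡ i
transpose-right {i = i} {j} {z} z≢i z≡j with z ≟ i
... | yes z≡i = ⊥-elim (z≢i z≡i)
... | no _ with z ≟ j
...   | yes _   = refl
...   | no z≢j  = ⊥-elim (z≢j z≡j)

inject₁≢suc : ∀ {n} (i : Fin n) → inject₁ i ≢ Fin.suc i
inject₁≢suc Fin.zero ()
inject₁≢suc (Fin.suc i) e = inject₁≢suc i (suc-injective e)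

module Matching {L : Set} {n : ℕ} (A B : Fin n → L) where

  Edge : Set
  Edge = Fin n × Fin n

  InH : Edge → Set
  InH (x , y) = A x ≡ B y

  Valid : (Fin n ↔ Fin n) → Set
  Valid σ = ∀ x → A x ≡ B (Inverse.to σ x)

  Uses : (Fin n ↔ Fin n) → Edge → Set
  Uses σ (x , y) = Inverse.to σ x ≡ y

  Compatible : Edge → Edge → Set
  Compatible (x , y) (x' , y') = (x ≡ x' → y ≡ y') × (y ≡ y' → x ≡ x')

  disjoint-compatible : ∀ {x y x' y'} → x ≢ x' → y ≢ y' → Compatible (x , y) (x' , y')
  disjoint-compatible x≢x' y≢y' = (λ e → ⊥-elim (x≢x' e)) , (λ e → ⊥-elim (y≢y' e))

  ConflictA ConflictB Conflict : Edge → Edge → Set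
  ConflictA (x , y) (x' , y') = x ≡ x' × y ≢ y'
  ConflictB (x , y) (x' , y') = y ≡ y' × x ≢ x'
  Conflict e f = ConflictA e f ⊎ ConflictB e f

  conflictA? : ∀ e → Decidable (ConflictA e)
  conflictA? (x , y) (x' , y') = (x ≟ x') ×-dec ¬? (y ≟ y')

  conflict? : ∀ e → Decidable (Conflict e)
  conflict? (x , y) (x' , y') = conflictA? (x , y) (x' , y') ⊎-dec ((y ≟ y') ×-dec ¬? (x ≟ x'))

  no-conflict-compatible : ∀ e f → ¬ Conflict e f → Compatible e f
  no-conflict-compatible (x , y) (x' , y') ¬c = sameA , sameB
    where
    sameA : x ≡ x' → y ≡ y'
    sameA x≡x' with y ≟ y'
    ... | yes y≡y' = y≡y'
    ... | no y≢y'  = ⊥-elim (¬c (inj₁ (x≡x' , y≢y')))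
    sameB : y ≡ y' → x ≡ x'
    sameB y≡y' with x ≟ x'
    ... | yes x≡x' = x≡x'
    ... | no x≢x'  = ⊥-elim (¬c (inj₂ (y≡y' , x≢x')))

  redirect : (Fin n ↔ Fin n) → Fin n → Fin n → Fin n ↔ Fin n
  redirect σ x y = transpose x (Inverse.from σ y) ∘ₚ σ

  redirect-hit : ∀ σ x y → Uses (redirect σ x y) (x , y)
  redirect-hit σ x y = trans (cong (Inverse.to σ) (transpose-left x _)) (inverseʳ σ)

  redirect-valid : ∀ σ → Valid σ → ∀ x y → InH (x , y) → Valid (redirect σ x y)
  redirect-valid σ V x y xy z = by-cases (z ≟ x) (z ≟ Inverse.from σ y)
    where
    by-cases : Dec (z ≡ x) → Dec (z ≡ Inverse.from σ y) → A z ≡ B (Inverse.to (redirect σ x y) z)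
    by-cases (yes refl) _ = trans xy (cong B (sym (redirect-hit σ x y)))
    by-cases (no z≢x) (yes z≡σ⁻¹y) =
      -- z was the preimage of y, so A z = B y = A x, and z now goes where x went.
      trans (V z) (trans (cong B σz≡y) (trans (sym xy) (trans (V x)
        (cong (B ∘ Inverse.to σ) (sym (transpose-right z≢x z≡σ⁻¹y))))))
      where
      σz≡y : Inverse.to σ z ≡ y
      σz≡y = trans (cong (Inverse.to σ) z≡σ⁻¹y) (inverseʳ σ)
    by-cases (no z≢x) (no z≢σ⁻¹y) =
      trans (V z) (cong (B ∘ Inverse.to σ) (sym (transpose-other z≢x z≢σ⁻¹y)))

  redirect-keep : ∀ σ x y {f} → Compatible (x , y) f → Uses σ f → Uses (redirect σ x y) f
  redirect-keep σ x y {x' , y'} (sameA , sameB) σx'≡y' with x ≟ x'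
  ... | yes refl = trans (redirect-hit σ x y) (sameA refl)
  ... | no x≢x' = trans (cong (Inverse.to σ) (transpose-other (x≢x' ∘ sym) x'≢σ⁻¹y)) σx'≡y'
    where
    x'≢σ⁻¹y : x' ≢ Inverse.from σ y
    x'≢σ⁻¹y e = x≢x' (sameB (sym (trans (sym σx'≡y') (trans (cong (Inverse.to σ) e) (inverseʳ σ)))))

  extend-matching : ∀ π → Valid π → (es : List Edge) → All InH es → AllPairs Compatible es →
    Σ (Fin n ↔ Fin n) λ σ → Valid σ × All (Uses σ) es
  extend-matching π V [] _ _ = π , V , []
  extend-matching π V ((x , y) ∷ es) (xy ∷ hs) (cs ∷ css) with extend-matching π V es hs css
  ... | σ , Vσ , us =
    redirect σ x y , redirect-valid σ Vσ x y xy ,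
    redirect-hit σ x y ∷ All.zipWith (λ {f} (c , u) → redirect-keep σ x y {f} c u) (cs , us)

module Neighbours {L : Set} {m : ℕ} (A B : Fin (suc m) → L) where
  open DuoGraph A B
  open Matching A B

  Vertex : Set
  Vertex = Fin m × Fin m

  edgeAt : (Fin m → Fin (suc m)) → Vertex → Edge
  edgeAt s (i , j) = s i , s j

  lower upper : Vertex → Edge
  lower = edgeAt inject₁
  upper = edgeAt Fin.suc

  lower-in-H : ∀ {w} → IsVertex w → InH (lower w)
  lower-in-H {_ , _} = proj₁

  upper-in-H : ∀ {w} → IsVertex w → InH (upper w)
  upper-in-H {_ , _} = proj₂

  lower-upper-compatible : ∀ v → Compatible (lower v) (upper v)
  lower-upper-compatible (i , j) = disjoint-compatible (inject₁≢suc i) (inject₁≢suc j)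

  upper-compatible : ∀ v w → Compatible (lower v) (lower w) → Compatible (upper v) (upper w)
  upper-compatible (i , j) (p , q) (sameA , sameB) = shift sameA , shift sameB
    where
    shift : ∀ {a b c d : Fin m} → (inject₁ a ≡ inject₁ b → inject₁ c ≡ inject₁ d) →
      Fin.suc a ≡ Fin.suc b → Fin.suc c ≡ Fin.suc d
    shift same e = cong Fin.suc (inject₁-injective (same (cong inject₁ (suc-injective e))))

  NeighbourType : Vertex → Vertex → Set
  NeighbourType v w =
    Conflict (lower v) (lower w) ⊎ (Conflict (lower v) (upper w) ⊎ Conflict (upper v) (lower w))

  neighbourType? : ∀ v → Decidable (NeighbourType v)
  neighbourType? v w =
    conflict? (lower v) (lower w) ⊎-dec (conflict? (lower v) (upper w) ⊎-dec conflict? (upper v) (lower w))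

  common-matching : ∀ π → Valid π → ∀ {v w} → IsVertex v → IsVertex w → ¬ NeighbourType v w →
    ∃ λ M → Contains M v × Contains M w
  common-matching π V {v@(_ , _)} {w@(_ , _)} isV isW ¬type
    with extend-matching π V (lower v ∷ upper v ∷ lower w ∷ upper w ∷ [])
           (lower-in-H isV ∷ upper-in-H isV ∷ lower-in-H isW ∷ upper-in-H isW ∷ [])
           ((lower-upper-compatible v ∷ ll ∷ lu ∷ []) ∷ (ul ∷ upper-compatible v w ll ∷ [])
             ∷ (lower-upper-compatible w ∷ []) ∷ [] ∷ [])
    where
    ll : Compatible (lower v) (lower w)
    ll = no-conflict-compatible _ _ (¬type ∘ inj₁)
    lu : Compatible (lower v) (upper w)
    lu = no-conflict-compatible _ _ (¬type ∘ inj₂ ∘ inj₁)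
    ul : Compatible (upper v) (lower w)
    ul = no-conflict-compatible _ _ (¬type ∘ inj₂ ∘ inj₂)
  ... | σ , Vσ , v₁ ∷ v₂ ∷ w₁ ∷ w₂ ∷ [] = (σ , Vσ) , (v₁ , v₂) , (w₁ , w₂)

  adjacent-conflict : ∀ π → Valid π → ∀ {v w} → IsVertex v → IsVertex w → Adjacent v w →
    NeighbourType v w
  adjacent-conflict π V {v} {w} isV isW (_ , ¬common) with neighbourType? v w
  ... | yes type = type
  ... | no ¬type = ⊥-elim (¬common (common-matching π V isV isW ¬type))

  module Counting (k : ℕ) (occA : AtMostOccurrences k A) (occB : AtMostOccurrences k B) where

    -- Vertices w whose s-edge conflicts with the edge e on the A-side: the A-endpoint
    -- s p of that edge is fixed, and s q ≠ y carries the letter of y.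
    conflictA-bound : ∀ s → (∀ {p p'} → s p ≡ s p' → p ≡ p') → ∀ e → InH e →
      Bounded (λ w → InH (edgeAt s w) × ConflictA e (edgeAt s w)) (k ∸ 1)
    conflictA-bound s s-inj (x , y) xy =
      same-letter-bound B occB y (λ w → s (proj₂ w)) letter distinct injective
      where
      letter : ∀ {w} → InH (edgeAt s w) × ConflictA (x , y) (edgeAt s w) → B (s (proj₂ w)) ≡ B y
      letter {_ , _} (inH , x≡sp , _) = trans (sym inH) (trans (cong A (sym x≡sp)) xy)
      distinct : ∀ {w} → InH (edgeAt s w) × ConflictA (x , y) (edgeAt s w) → s (proj₂ w) ≢ y
      distinct {_ , _} (_ , _ , y≢sq) = y≢sq ∘ sym
      injective : ∀ {w w'} → InH (edgeAt s w) × ConflictA (x , y) (edgeAt s w) →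
        InH (edgeAt s w') × ConflictA (x , y) (edgeAt s w') → s (proj₂ w) ≡ s (proj₂ w') → w ≡ w'
      injective {_ , _} {_ , _} (_ , x≡sp , _) (_ , x≡sp' , _) sq≡sq' =
        cong₂ _,_ (s-inj (trans (sym x≡sp) x≡sp')) (s-inj sq≡sq')

    conflictB-bound : ∀ s → (∀ {p p'} → s p ≡ s p' → p ≡ p') → ∀ e → InH e →
      Bounded (λ w → InH (edgeAt s w) × ConflictB e (edgeAt s w)) (k ∸ 1)
    conflictB-bound s s-inj (x , y) xy =
      same-letter-bound A occA x (λ w → s (proj₁ w)) letter distinct injective
      where
      letter : ∀ {w} → InH (edgeAt s w) × ConflictB (x , y) (edgeAt s w) → A (s (proj₁ w)) ≡ A x
      letter {_ , _} (inH , y≡sq , _) = trans inH (trans (cong B (sym y≡sq)) (sym xy))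
      distinct : ∀ {w} → InH (edgeAt s w) × ConflictB (x , y) (edgeAt s w) → s (proj₁ w) ≢ x
      distinct {_ , _} (_ , _ , x≢sp) = x≢sp ∘ sym
      injective : ∀ {w w'} → InH (edgeAt s w) × ConflictB (x , y) (edgeAt s w) →
        InH (edgeAt s w') × ConflictB (x , y) (edgeAt s w') → s (proj₁ w) ≡ s (proj₁ w') → w ≡ w'
      injective {_ , _} {_ , _} (_ , y≡sq , _) (_ , y≡sq' , _) sp≡sp' =
        cong₂ _,_ (s-inj sp≡sp') (s-inj (trans (sym y≡sq) y≡sq'))

    pairBound : ℕ
    pairBound = (k ∸ 1) + (k ∸ 1)

    conflict-bound : ∀ s → (∀ {p p'} → s p ≡ s p' → p ≡ p') → ∀ e → InH e →
      Bounded (λ w → InH (edgeAt s w) × Conflict e (edgeAt s w)) pairBound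
    conflict-bound s s-inj e inH =
      bounded-∪ (conflictA? e ∘ edgeAt s) (conflictA-bound s s-inj e inH) (conflictB-bound s s-inj e inH)

    neighbour-bound : ∀ {v} → IsVertex v →
      Bounded (IsVertex ∩ NeighbourType v) (pairBound + (pairBound + pairBound))
    neighbour-bound {v} isV =
      bounded-∪ (conflict? (lower v) ∘ lower) (via-lower (lower v) (lower-in-H isV))
        (bounded-∪ (conflict? (lower v) ∘ upper) via-upper (via-lower (upper v) (upper-in-H isV)))
      where
      via-lower : ∀ e → InH e → Bounded (IsVertex ∩ (Conflict e ∘ lower)) pairBound
      via-lower e inH = bounded-mono (λ {w} (isW , c) → lower-in-H {w} isW , c)
                          (conflict-bound inject₁ inject₁-injective e inH)
      via-upper : Bounded (IsVertex ∩ (Conflict (lower v) ∘ upper)) pairBound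
      via-upper = bounded-mono (λ {w} (isW , c) → upper-in-H {w} isW , c)
                    (conflict-bound Fin.suc suc-injective (lower v) (lower-in-H isV))

three-pair-bounds : ∀ a → (a + a) + ((a + a) + (a + a)) ≡ 6 * a
three-pair-bounds = solve-∀

corollary2p2 : {L : Set} (k m : ℕ) → 1 ≤ k → (A B : Fin (suc m) → L)
    → (∃ λ (π : Fin (suc m) ↔ Fin (suc m)) → ∀ x → A x ≡ B (Inverse.to π x))
    → AtMostOccurrences k A → AtMostOccurrences k B
    → (v : Fin m × Fin m) → DuoGraph.IsVertex A B v
    → DuoGraph.DegreeAtMost A B v (6 * (k ∸ 1))
corollary2p2 k m _ A B (π , valid) occA occB v isV =
  bounded-mono (λ {w} (isW , adj) → isW , adjacent-conflict π valid isV isW adj)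
    (bounded-≤ (≤-reflexive (three-pair-bounds (k ∸ 1))) (neighbour-bound isV))
  where
  open Neighbours A B
  open Counting k occA occB
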